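{- Let $T$ be a semilabeled binary tree of size $n$ and $\mathcal{P}\in\mathfrak{P}(T)$. Then (i) $|S(\mathcal{P})|\ne n-1$; (ii) if $|S(\mathcal{P})|\in\{n,n-2,n-3\}$, then $\mathcal{P}$ has at most one class of size at least $2$; (iii) if $|S(\mathcal{P})|\ge n-3$, then $|S(\mathcal{P})|\ge 2|\mathcal{P}|-n$, where $|\mathcal{P}|$ is the number of classes of $\mathcal{P}$.
   Context: A semilabeled binary tree of size $n$ is a tree all of whose vertices have degree $1$ or $3$, with exactly $n$ leaves labeled bijectively by $[n]=\{1,\dots,n\}$. $\mathfrak{P}(T)$ is the set of partitions of $[n]$ obtained by deleting some set of edges of $T$ and putting two leaf labels in the same class iff they lie in the same component of the resulting forest (components without leaves ignored). For a partition $\mathcal{P}$, $S(\mathcal{P})=\{c:\{c\}\in\mathcal{P}\}$ is the set of elements forming singleton classes. -}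

module Defs where

open import Data.Nat using (ℕ; zero; suc; _+_; _*_; _≤_; _≤?_)
open import Data.Fin using (Fin)
open import Data.Fin.Properties using (_≟_)
open import Data.Bool using (Bool; true)
open import Data.List using (List; []; _∷_; length; filter; concat; allFin)
open import Data.List.Membership.Propositional using (_∈_)
open import Data.List.Relation.Unary.Any using (Any)
open import Data.List.Relation.Unary.All using (All)
open import Data.List.Relation.Unary.Unique.Propositional using (Unique)
open import Data.List.Relation.Binary.Permutation.Propositional using (_↭_)
open import Data.Product using (Σ; _×_; proj₁; proj₂)
open import Data.Nat using () renaming (_≟_ to _≟ℕ_)
open import Data.Sum using (_⊎_)
open import Function.Bundles using (_⇔_)
open import Relation.Binary.PropositionalEquality using (_≡_; _≢_)

-- Finite multigraphs: vertices Fin V, edges indexed by Fin E,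
-- edge i joins proj₁ (ends i) and proj₂ (ends i).

data Walk {V E : ℕ} (ends : Fin E → Fin V × Fin V) (keep : Fin E → Bool)
          : Fin V → Fin V → List (Fin E) → Set where
  here  : ∀ {v} → Walk ends keep v v []
  fwd   : ∀ {w es} (i : Fin E) → keep i ≡ true →
          Walk ends keep (proj₂ (ends i)) w es →
          Walk ends keep (proj₁ (ends i)) w (i ∷ es)
  bwd   : ∀ {w es} (i : Fin E) → keep i ≡ true →
          Walk ends keep (proj₁ (ends i)) w es →
          Walk ends keep (proj₂ (ends i)) w (i ∷ es)

Conn : {V E : ℕ} → (Fin E → Fin V × Fin V) → (Fin E → Bool) → Fin V → Fin V → Set
Conn ends keep u v = Σ (List _) λ es → Walk ends keep u v es

allEdges : {E : ℕ} → Fin E → Bool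
allEdges _ = true

-- degree of a vertex (a loop would count twice)
degree : {V E : ℕ} → (Fin E → Fin V × Fin V) → Fin V → ℕ
degree {V} {E} ends v =
  length (filter (λ i → proj₁ (ends i) ≟ v) (allFin E)) +
  length (filter (λ i → proj₂ (ends i) ≟ v) (allFin E))

-- A tree: nonempty, connected, acyclic (no closed trail of positive length).

record SemilabeledBinaryTree (n : ℕ) : Set where
  field
    V         : ℕ            -- number of vertices minus one (tree is nonempty)
    E         : ℕ
    ends      : Fin E → Fin (suc V) × Fin (suc V)
    connected : ∀ u v → Conn ends allEdges u v
    acyclic   : ∀ v es → Walk ends allEdges v v es → Unique es → es ≡ []
    degree13  : ∀ v → degree ends v ≡ 1 ⊎ degree ends v ≡ 3
    leaf      : Fin n → Fin (suc V)
    leaf-inj  : ∀ a b → leaf a ≡ leaf b → a ≡ b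
    leaf-deg  : ∀ a → degree ends (leaf a) ≡ 1
    leaf-surj : ∀ v → degree ends v ≡ 1 → Σ (Fin n) λ a → leaf a ≡ v

-- Partitions of [n] = Fin n, as lists of classes: every class nonempty,
-- and the classes together contain every element exactly once.

Partition : ℕ → Set
Partition n = List (List (Fin n))

IsPartition : {n : ℕ} → Partition n → Set
IsPartition {n} P = All (λ C → C ≢ []) P × (concat P ↭ allFin n)

SameClass : {n : ℕ} → Partition n → Fin n → Fin n → Set
SameClass P a b = Any (λ C → a ∈ C × b ∈ C) P

-- 𝔓(T): partitions induced by deleting some set of edges
-- (equivalently keeping the complementary set `keep`)
InducedPartition : {n : ℕ} → SemilabeledBinaryTree n → Partition n → Set
InducedPartition {n} T P =
  IsPartition P ×
  Σ (Fin E → Bool) λ keep →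
    ∀ (a b : Fin n) → SameClass P a b ⇔ Conn ends keep (leaf a) (leaf b)
  where open SemilabeledBinaryTree T

numClasses : {n : ℕ} → Partition n → ℕ
numClasses P = length P

-- |S(P)| : number of singleton classes (= number of elements in singletons)
numSingletons : {n : ℕ} → Partition n → ℕ
numSingletons P = length (filter (λ C → length C ≟ℕ 1) P)

numBigClasses : {n : ℕ} → Partition n → ℕ
numBigClasses P = length (filter (λ C → 2 ≤? length C) P)

module Submission where

open import Defs
open import Data.Nat using (ℕ; suc; _+_; _*_; _≤_; z≤n; s≤s; _≤?_)
open import Data.Nat.Properties
open import Algebra.Properties.CommutativeSemigroup +-commutativeSemigroup using (x∙yz≈y∙xz)
open import Data.List using (List; []; _∷_; _++_; length; concat; filter; allFin)
open import Data.List.Properties using (length-++; length-tabulate)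
open import Data.List.Relation.Unary.All using (All; []; _∷_)
open import Data.List.Relation.Unary.All.Properties using (all-filter)
open import Data.List.Relation.Binary.Permutation.Propositional.Properties using (↭-length)
open import Data.Product using (_×_; _,_)
open import Data.Sum using (_⊎_; inj₁; inj₂)
open import Data.Empty using (⊥-elim)
open import Relation.Binary.PropositionalEquality
  using (_≡_; _≢_; refl; sym; trans; cong; subst; module ≡-Reasoning)

-- That mass is never 1, which gives (i); it is at least twice the number
-- of non-singleton classes, which gives (ii) when it is at most 3, and
-- (iii) without the hypothesis |S(P)| ≥ n − 3.

bigClasses : {n : ℕ} → Partition n → Partition n
bigClasses = filter (λ C → 2 ≤? length C)

bigMass : {n : ℕ} → Partition n → ℕ
bigMass P = length (concat (bigClasses P))

module _ {A : Set} where

  double-length≤length-concat : {Q : List (List A)} → All (λ C → 2 ≤ length C) Q →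
                                2 * length Q ≤ length (concat Q)
  double-length≤length-concat {[]}    []          = z≤n
  double-length≤length-concat {C ∷ Q} (2≤C ∷ 2≤Q) = begin
    2 * suc (length Q)           ≡⟨ *-suc 2 (length Q) ⟩
    2 + 2 * length Q             ≤⟨ +-mono-≤ 2≤C (double-length≤length-concat 2≤Q) ⟩
    length C + length (concat Q) ≡⟨ length-++ C ⟨
    length (concat (C ∷ Q))      ∎
    where open ≤-Reasoning

  length-concat≢1 : {Q : List (List A)} → All (λ C → 2 ≤ length C) Q → length (concat Q) ≢ 1
  length-concat≢1 {[]}    []        ()
  length-concat≢1 {C ∷ Q} (2≤C ∷ _) eq =
    <-irrefl (sym eq) (≤-trans 2≤C (≤-trans (m≤m+n (length C) _) (≤-reflexive (sym (length-++ C)))))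

module _ {n : ℕ} where

  numClasses-split : {P : Partition n} → All (_≢ []) P →
                     numClasses P ≡ numSingletons P + numBigClasses P
  numClasses-split {[]}              []        = refl
  numClasses-split {[] ∷ _}          (ne ∷ _)  = ⊥-elim (ne refl)
  numClasses-split {(_ ∷ []) ∷ _}    (_ ∷ nes) = cong suc (numClasses-split nes)
  numClasses-split {(_ ∷ _ ∷ _) ∷ P} (_ ∷ nes) = begin
    suc (length P)                           ≡⟨ cong suc (numClasses-split nes) ⟩
    suc (numSingletons P + numBigClasses P)  ≡⟨ +-suc (numSingletons P) _ ⟨
    numSingletons P + suc (numBigClasses P)  ∎
    where open ≡-Reasoning

  length-concat-split : {P : Partition n} → All (_≢ []) P →
                        length (concat P) ≡ numSingletons P + bigMass P
  length-concat-split {[]}                []        = refl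
  length-concat-split {[] ∷ _}            (ne ∷ _)  = ⊥-elim (ne refl)
  length-concat-split {(_ ∷ []) ∷ _}      (_ ∷ nes) = cong suc (length-concat-split nes)
  length-concat-split {C@(_ ∷ _ ∷ _) ∷ P} (_ ∷ nes) = begin
    length (C ++ concat P)                                ≡⟨ length-++ C ⟩
    length C + length (concat P)                          ≡⟨ cong (length C +_) (length-concat-split nes) ⟩
    length C + (numSingletons P + bigMass P)              ≡⟨ x∙yz≈y∙xz (length C) _ _ ⟩
    numSingletons P + (length C + bigMass P)              ≡⟨ cong (numSingletons P +_) (length-++ C) ⟨
    numSingletons P + length (C ++ concat (bigClasses P)) ∎
    where open ≡-Reasoning

  size≡numSingletons+bigMass : {P : Partition n} → IsPartition P → n ≡ numSingletons P + bigMass P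
  size≡numSingletons+bigMass {P} (nes , concat↭) = begin
    n                           ≡⟨ length-tabulate {n = n} (λ i → i) ⟨
    length (allFin n)           ≡⟨ ↭-length concat↭ ⟨
    length (concat P)           ≡⟨ length-concat-split nes ⟩
    numSingletons P + bigMass P ∎
    where open ≡-Reasoning

  double-numBigClasses≤bigMass : (P : Partition n) → 2 * numBigClasses P ≤ bigMass P
  double-numBigClasses≤bigMass P = double-length≤length-concat (all-filter (λ C → 2 ≤? length C) P)

  suc-numSingletons≢size : {P : Partition n} → IsPartition P → suc (numSingletons P) ≢ n
  suc-numSingletons≢size {P} isP s+1≡n =
    length-concat≢1 (all-filter (λ C → 2 ≤? length C) P) (sym (+-cancelˡ-≡ s 1 (bigMass P) s+1≡s+m))
    where
    s : ℕ
    s = numSingletons P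
    s+1≡s+m : s + 1 ≡ s + bigMass P
    s+1≡s+m = trans (+-comm s 1) (trans s+1≡n (size≡numSingletons+bigMass isP))

  numBigClasses≤1 : {P : Partition n} → IsPartition P → n ≤ numSingletons P + 3 → numBigClasses P ≤ 1
  numBigClasses≤1 {P} isP n≤s+3 =
    ≤-pred (*-cancelˡ-< 2 _ 2 (≤-<-trans (double-numBigClasses≤bigMass P) (s≤s m≤3)))
    where
    m≤3 : bigMass P ≤ 3
    m≤3 = +-cancelˡ-≤ (numSingletons P) _ 3
            (subst (_≤ numSingletons P + 3) (size≡numSingletons+bigMass isP) n≤s+3)

  double-numClasses≤numSingletons+size : {P : Partition n} → IsPartition P →
                                         2 * numClasses P ≤ numSingletons P + n
  double-numClasses≤numSingletons+size {P} isP@(nes , _) = begin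
    2 * numClasses P             ≡⟨ cong (2 *_) (numClasses-split nes) ⟩
    2 * (s + numBigClasses P)    ≡⟨ *-distribˡ-+ 2 s _ ⟩
    2 * s + 2 * numBigClasses P  ≤⟨ +-monoʳ-≤ (2 * s) (double-numBigClasses≤bigMass P) ⟩
    2 * s + bigMass P            ≡⟨ cong (λ k → s + k + bigMass P) (+-identityʳ s) ⟩
    s + s + bigMass P            ≡⟨ +-assoc s s _ ⟩
    s + (s + bigMass P)          ≡⟨ cong (s +_) (size≡numSingletons+bigMass isP) ⟨
    s + n                        ∎
    where
    open ≤-Reasoning
    s : ℕ
    s = numSingletons P

lemma8p2 : (n : ℕ) (T : SemilabeledBinaryTree n) (P : Partition n) →
           InducedPartition T P →
           (suc (numSingletons P) ≢ n)
           × ((numSingletons P ≡ n ⊎ numSingletons P + 2 ≡ n ⊎ numSingletons P + 3 ≡ n) →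
                numBigClasses P ≤ 1)
           × (n ≤ numSingletons P + 3 →
                2 * numClasses P ≤ numSingletons P + n)
lemma8p2 n _ P (isP , _) =
  suc-numSingletons≢size isP ,
  (λ cases → numBigClasses≤1 isP (n≤s+3 cases)) ,
  (λ _ → double-numClasses≤numSingletons+size isP)
  where
  s : ℕ
  s = numSingletons P
  n≤s+3 : (s ≡ n ⊎ s + 2 ≡ n ⊎ s + 3 ≡ n) → n ≤ s + 3
  n≤s+3 (inj₁ s≡n)          = ≤-trans (≤-reflexive (sym s≡n)) (m≤m+n s 3)
  n≤s+3 (inj₂ (inj₁ s+2≡n)) = ≤-trans (≤-reflexive (sym s+2≡n)) (+-monoʳ-≤ s (n≤1+n 2))
  n≤s+3 (inj₂ (inj₂ s+3≡n)) = ≤-reflexive (sym s+3≡n)
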